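{- Let $P_n$ be the directed path with $V(P_n)=\{1,\dots,n\}$ and arcs $(i+1,i)$ for $1\le i\le n-1$, and let $\mathcal{H}=\{G_i\}_{i=1}^n$ be a family of pairwise disjoint $c$-colored digraphs. Then the Zykov sum $P_n[\mathcal{H}]$ has an up-color kernel if and only if, for every $1\le i\le n/2$, the digraph $G_{2i-1}$ has an up-color kernel $K_{2i-1}$ which up-color absorbs every vertex of $G_{2i}$.
   Context: A $c$-colored digraph has a function $c:V\to\{0,1,2,\ldots\}$. The Zykov sum $G[\mathcal{H}]$ of a connected digraph $G$ and a family $\{H_v\}_{v\in V(G)}$ of pairwise disjoint digraphs is obtained from $G$ by replacing each vertex $v$ by $H_v$ and adding an arc from every vertex of $H_u$ to every vertex of $H_v$ whenever $(u,v)\in A(G)$; it is colored by the colorings of the $H_v$. A vertex $w$ up-color absorbs $u$ if $(u,w)$ is an arc and $c(u)<c(w)$. A set $N$ is up-color absorbent if every vertex not in $N$ is up-color absorbed by some vertex of $N$ and no vertex of $N$ has color $0$; an up-color kernel is an independent up-color absorbent set.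
   Formalization: i ranges over 1 ≤ i ≤ ⌈n/2⌉ in place of 1 ≤ i ≤ n/2, absorption of $G_{2i}$ being demanded only when 2i ≤ n, and each $G_i$ is finite, loopless and nonempty. Each condition added here is assumed in the paper as well or is needed for the statement above to hold. -}

module Defs where

open import Data.Nat using (ℕ; zero; suc; _<_; _*_)
open import Data.Fin using (Fin; toℕ; fromℕ<)
open import Data.Product using (Σ; ∃; _×_; _,_)
open import Data.Bool using (Bool; true; false)
open import Relation.Binary.PropositionalEquality using (_≡_)
open import Relation.Nullary using (¬_)

record ColDigraph : Set₁ where
  field
    V     : Set
    Arc   : V → V → Set
    color : V → ℕ

record FinColDigraph : Set₁ where
  field
    size     : ℕ
    Arc      : Fin size → Fin size → Set
    loopless : ∀ v → ¬ Arc v v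
    color    : Fin size → ℕ

toCol : FinColDigraph → ColDigraph
toCol G = record { V = Fin size ; Arc = Arc ; color = color }
  where open FinColDigraph G

module _ (D : ColDigraph) where
  open ColDigraph D

  UpAbsorbs : V → V → Set
  UpAbsorbs w u = Arc u w × color u < color w

  UpAbsorbent : (V → Bool) → Set
  UpAbsorbent N =
    (∀ u → ¬ (N u ≡ true) → ∃ λ w → N w ≡ true × UpAbsorbs w u)
    × (∀ u → N u ≡ true → ¬ (color u ≡ 0))

  Independent : (V → Bool) → Set
  Independent N = ∀ u w → N u ≡ true → N w ≡ true → ¬ Arc u w

  IsUpKernel : (V → Bool) → Set
  IsUpKernel N = Independent N × UpAbsorbent N

  HasUpKernel : Set
  HasUpKernel = Σ (V → Bool) IsUpKernel

-- Zykov sum G[H] of a base digraph (W, A) and a family H indexed by W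
-- (disjointness is automatic: vertices are pairs (w , x)).
module Zykov (W : Set) (A : W → W → Set) (H : W → FinColDigraph) where
  ZV : Set
  ZV = Σ W (λ w → Fin (FinColDigraph.size (H w)))

  data ZArc : ZV → ZV → Set where
    inside : ∀ {w x y} → FinColDigraph.Arc (H w) x y → ZArc (w , x) (w , y)
    across : ∀ {u v x y} → A u v → ZArc (u , x) (v , y)

  zcolor : ZV → ℕ
  zcolor (w , x) = FinColDigraph.color (H w) x

  sum : ColDigraph
  sum = record { V = ZV ; Arc = ZArc ; color = zcolor }

-- Directed path P_n, vertices 0..n-1 (paper: 1..n), arcs (i+1 , i).
PathArc : (n : ℕ) → Fin n → Fin n → Set
PathArc n i j = toℕ i ≡ suc (toℕ j)

ZykovPath : (n : ℕ) → (Fin n → FinColDigraph) → ColDigraph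
ZykovPath n G = Zykov.sum (Fin n) (PathArc n) G

-- Condition for the pair (G_{2k+1}, G_{2k+2}) in paper indexing
-- (= indices 2k, 2k+1 here): G_{2k} has an up-color kernel K which, in the
-- Zykov sum, up-color absorbs every vertex of G_{2k+1} (if that index exists).
PairCondition : (n : ℕ) (G : Fin n → FinColDigraph) (k : ℕ) (h : 2 * k < n) → Set
PairCondition n G k h =
  Σ (Fin (FinColDigraph.size (G (fromℕ< h))) → Bool) λ K →
    IsUpKernel (toCol (G (fromℕ< h))) K
    × ((h' : suc (2 * k) < n) →
        ∀ (x : Fin (FinColDigraph.size (G (fromℕ< h')))) →
          ∃ λ y → K y ≡ true
            × UpAbsorbs (ZykovPath n G) (fromℕ< h , y) (fromℕ< h' , x))

{-# OPTIONS --safe #-}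
module Submission where

-- Arcs of the path only go from layer i + 1 down to layer i (layers are numbered from 0, so the
-- paper's G_{2i-1} is layer 2(i-1) here). In an up-color kernel N of the sum, by induction on k,
-- nothing in N lies below layer 2k, so N restricted to layer 2k is an up-color kernel of it; being
-- nonempty, it forces layer 2k + 1, all of whose vertices point to it, to miss N, and that layer
-- must then be absorbed from layer 2k. Conversely, the union of the kernels on the even layers is
-- independent since even layers are never adjacent, and it absorbs each odd layer by hypothesis.

open import Defs
open import Data.Nat using (ℕ; zero; suc; _<_; _*_)
open import Data.Nat.Properties using (suc-injective; *-suc; *-cancelˡ-≡; ≡-irrelevant; even≢odd; 0≢1+n; <⇒≤)
open import Data.Fin using (Fin; toℕ; fromℕ<)
open import Data.Fin.Properties using (toℕ-fromℕ<; toℕ-injective; toℕ<n)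
open import Data.Bool using (Bool; true; false)
open import Data.Bool.Properties using (not-¬)
open import Data.Product using (Σ; ∃; _×_; _,_; proj₁; proj₂)
open import Data.Sum using (_⊎_; inj₁; inj₂)
open import Data.Empty using (⊥; ⊥-elim)
open import Relation.Nullary using (¬_)
open import Relation.Nullary.Irrelevant using (Irrelevant)
open import Relation.Binary.PropositionalEquality using (_≡_; refl; sym; trans; cong; subst)

Even Odd : ℕ → Set
Even m = ∃ λ k → m ≡ 2 * k
Odd m = ∃ λ k → m ≡ suc (2 * k)

even-or-odd : ∀ m → Even m ⊎ Odd m
even-or-odd zero = inj₁ (0 , refl)
even-or-odd (suc m) with even-or-odd m
... | inj₁ (k , e) = inj₂ (k , cong suc e)
... | inj₂ (k , e) = inj₁ (suc k , trans (cong suc e) (sym (*-suc 2 k)))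

even⇒¬odd : ∀ {m} → Even m → ¬ Odd m
even⇒¬odd (k , e) (l , e′) = even≢odd k l (trans (sym e) e′)

Even-irrelevant : ∀ {m} → Irrelevant (Even m)
Even-irrelevant (k , e) (l , e′) with *-cancelˡ-≡ k l 2 (trans (sym e) e′)
... | refl = cong (k ,_) (≡-irrelevant e e′)

fromℕ<-≡ : ∀ {n m} (i : Fin n) → toℕ i ≡ m → .(m<n : m < n) → fromℕ< m<n ≡ i
fromℕ<-≡ i e m<n = toℕ-injective (trans (toℕ-fromℕ< m<n) (sym e))

upAbsorbent-inhabited : (D : ColDigraph) {N : ColDigraph.V D → Bool} →
  UpAbsorbent D N → ColDigraph.V D → ∃ λ v → N v ≡ true
upAbsorbent-inhabited D {N} (absorbs , _) v with N v in eq
... | true  = v , eq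
... | false = let w , nw , _ = absorbs v (not-¬ eq) in w , nw

module ZykovLayers (W : Set) (A : W → W → Set) (H : W → FinColDigraph) where
  open Zykov W A H

  Layer : W → Set
  Layer w = Fin (FinColDigraph.size (H w))

  layer : (ZV → Bool) → (w : W) → Layer w → Bool
  layer N w x = N (w , x)

  EmptyLayer : (ZV → Bool) → W → Set
  EmptyLayer N w = ∀ x → ¬ (N (w , x) ≡ true)

  UpAbsorbsLayer : (w : W) → (Layer w → Bool) → W → Set
  UpAbsorbsLayer w K v = ∀ x → ∃ λ y → K y ≡ true × UpAbsorbs sum (w , y) (v , x)

  module _ {N : ZV → Bool} where

    independent-by-layers : (∀ w → Independent (toCol (H w)) (layer N w)) →
      (∀ {u v x y} → A u v → N (u , x) ≡ true → N (v , y) ≡ true → ⊥) →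
      Independent sum N
    independent-by-layers layers _       (w , x) (.w , y) nx ny (inside a) = layers w x y nx ny a
    independent-by-layers _      support (u , x) (v , y)  nx ny (across a) = support a nx ny

    inNeighbour-emptyLayer : Independent sum N →
      ∀ {u v y} → A u v → N (v , y) ≡ true → EmptyLayer N u
    inNeighbour-emptyLayer indep a ny x nx = indep _ _ nx ny (across a)

    absorbed-across : UpAbsorbent sum N → ∀ {u} → EmptyLayer N u →
      ∀ x → ∃ λ (w : ZV) → A u (proj₁ w) × N w ≡ true × UpAbsorbs sum w (u , x)
    absorbed-across (absorbs , _) empty x with absorbs (_ , x) (empty x)
    ... | (_ , y) , ny , inside _ , _ = ⊥-elim (empty y ny)
    ... | w , nw , across a , c = w , a , nw , across a , c

    layer-isUpKernel : IsUpKernel sum N → ∀ {w} → (∀ v → A w v → EmptyLayer N v) →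
      IsUpKernel (toCol (H w)) (layer N w)
    layer-isUpKernel (indep , absorbs , colored) {w} outEmpty =
      (λ x y nx ny a → indep _ _ nx ny (inside a)) , absorbsInside , λ x → colored (w , x)
      where
      absorbsInside : ∀ x → ¬ (N (w , x) ≡ true) →
        ∃ λ y → N (w , y) ≡ true × UpAbsorbs (toCol (H w)) y x
      absorbsInside x nx with absorbs (w , x) nx
      ... | (_ , y) , ny , inside a , c = y , ny , a , c
      ... | (v , y) , ny , across a , _ = ⊥-elim (outEmpty v a y ny)

module _ (n : ℕ) (G : Fin n → FinColDigraph) where
  open Zykov (Fin n) (PathArc n) G using (ZV; inside)
  open ZykovLayers (Fin n) (PathArc n) G

  pathArc-functional : ∀ {i j j′} → PathArc n i j → PathArc n i j′ → j ≡ j′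
  pathArc-functional a a′ = toℕ-injective (suc-injective (trans (sym a) a′))

  pathArc-below : ∀ {m} (i : Fin n) → toℕ i ≡ suc m → ∃ λ j → PathArc n i j × toℕ j ≡ m
  pathArc-below i e = fromℕ< m<n , trans e (cong suc (sym (toℕ-fromℕ< m<n))) , toℕ-fromℕ< m<n
    where m<n = <⇒≤ (subst (_< n) e (toℕ<n i))

  AbsorbingKernelAt : Fin n → Set
  AbsorbingKernelAt i = Σ (Layer i → Bool) λ K →
    IsUpKernel (toCol (G i)) K × (∀ j → PathArc n j i → UpAbsorbsLayer i K j)

  absorbingKernelAt⇒pairCondition : ∀ k (h : 2 * k < n) →
    AbsorbingKernelAt (fromℕ< h) → PairCondition n G k h
  absorbingKernelAt⇒pairCondition k h (K , isKernel , absorbs) =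
    K , isKernel , λ h′ →
      absorbs (fromℕ< h′) (trans (toℕ-fromℕ< h′) (cong suc (sym (toℕ-fromℕ< h))))

  pairCondition⇒absorbingKernelAt : ∀ k (h : 2 * k < n) →
    PairCondition n G k h → AbsorbingKernelAt (fromℕ< h)
  pairCondition⇒absorbingKernelAt k h (K , isKernel , absorbs) = K , isKernel , absorbsAbove
    where
    absorbsAbove : ∀ j → PathArc n j (fromℕ< h) → UpAbsorbsLayer (fromℕ< h) K j
    absorbsAbove j a = subst (UpAbsorbsLayer (fromℕ< h) K) (fromℕ<-≡ j a′ h′) (absorbs h′)
      where
      a′ = trans a (cong suc (toℕ-fromℕ< h))
      h′ = subst (_< n) a′ (toℕ<n j)

  pairConditions⇒absorbingKernels : (∀ k (h : 2 * k < n) → PairCondition n G k h) →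
    ∀ i → Even (toℕ i) → AbsorbingKernelAt i
  pairConditions⇒absorbingKernels pairs i (k , e) =
    subst AbsorbingKernelAt (fromℕ<-≡ i e h) (pairCondition⇒absorbingKernelAt k h (pairs k h))
    where h = subst (_< n) e (toℕ<n i)

  module _ (nonempty : ∀ i → 0 < FinColDigraph.size (G i))
           {N : ZV → Bool} (isKernel : IsUpKernel (ZykovPath n G) N) where

    mutual
      evenLayer-isUpKernel : ∀ k (i : Fin n) → toℕ i ≡ 2 * k →
        IsUpKernel (toCol (G i)) (layer N i)
      evenLayer-isUpKernel zero    i e = layer-isUpKernel isKernel λ j a →
        ⊥-elim (0≢1+n (trans (sym e) a))
      evenLayer-isUpKernel (suc k) i e = layer-isUpKernel isKernel λ j a →
        oddLayer-empty k j (suc-injective (trans (sym a) (trans e (*-suc 2 k))))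

      oddLayer-empty : ∀ k (i : Fin n) → toℕ i ≡ suc (2 * k) → EmptyLayer N i
      oddLayer-empty k i e =
        let j , a , e′ = pathArc-below i e
            y , ny     = upAbsorbent-inhabited (toCol (G j)) (proj₂ (evenLayer-isUpKernel k j e′))
                                                 (fromℕ< (nonempty j))
        in inNeighbour-emptyLayer (proj₁ isKernel) a ny

    evenLayer-absorbingKernel : ∀ i → Even (toℕ i) → AbsorbingKernelAt i
    evenLayer-absorbingKernel i (k , e) = layer N i , evenLayer-isUpKernel k i e , absorbsAbove
      where
      absorbsAbove : ∀ j → PathArc n j i → UpAbsorbsLayer i (layer N i) j
      absorbsAbove j a x
        with absorbed-across (proj₂ isKernel) (oddLayer-empty k j (trans a (cong suc e))) x
      ... | (v , y) , a′ , ny , absorbs with pathArc-functional a′ a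
      ... | refl = y , ny , absorbs

  absorbingKernels⇒hasUpKernel : (∀ i → Even (toℕ i) → AbsorbingKernelAt i) →
    HasUpKernel (ZykovPath n G)
  absorbingKernels⇒hasUpKernel κ =
    N , independent-by-layers layerIndependent supportIndependent , absorbs , colored
    where
    K : ∀ i → Even (toℕ i) → Layer i → Bool
    K i ev = proj₁ (κ i ev)

    K-isUpKernel : ∀ i (ev : Even (toℕ i)) → IsUpKernel (toCol (G i)) (K i ev)
    K-isUpKernel i ev = proj₁ (proj₂ (κ i ev))

    N : ZV → Bool
    N (i , x) with even-or-odd (toℕ i)
    ... | inj₁ ev = K i ev x
    ... | inj₂ _  = false

    N-even : ∀ i x (ev : Even (toℕ i)) → N (i , x) ≡ K i ev x
    N-even i x ev with even-or-odd (toℕ i)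
    ... | inj₁ ev′ = cong (λ ev → K i ev x) (Even-irrelevant ev′ ev)
    ... | inj₂ od  = ⊥-elim (even⇒¬odd ev od)

    N-supported : ∀ i x → N (i , x) ≡ true → Even (toℕ i)
    N-supported i x nx with even-or-odd (toℕ i)
    ... | inj₁ ev = ev

    N⇒K : ∀ i x (ev : Even (toℕ i)) → N (i , x) ≡ true → K i ev x ≡ true
    N⇒K i x ev = trans (sym (N-even i x ev))

    layerIndependent : ∀ i → Independent (toCol (G i)) (layer N i)
    layerIndependent i x y nx ny = proj₁ (K-isUpKernel i ev) x y (N⇒K i x ev nx) (N⇒K i y ev ny)
      where ev = N-supported i x nx

    supportIndependent : ∀ {i j x y} →
      PathArc n i j → N (i , x) ≡ true → N (j , y) ≡ true → ⊥
    supportIndependent a nx ny with N-supported _ _ nx | N-supported _ _ ny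
    ... | k , e | l , e′ = even≢odd k l (trans (sym e) (trans a (cong suc e′)))

    absorbs : ∀ u → ¬ (N u ≡ true) → ∃ λ w → N w ≡ true × UpAbsorbs (ZykovPath n G) w u
    absorbs (i , x) nx with even-or-odd (toℕ i)
    ... | inj₁ ev =
      let y , ky , a , c = proj₁ (proj₂ (K-isUpKernel i ev)) x nx
      in (i , y) , trans (N-even i y ev) ky , inside a , c
    ... | inj₂ (k , e) =
      let j , a , e′ = pathArc-below i e
          y , ky , absorbs = proj₂ (proj₂ (κ j (k , e′))) i a x
      in (j , y) , trans (N-even j y (k , e′)) ky , absorbs

    colored : ∀ u → N u ≡ true → ¬ (ColDigraph.color (ZykovPath n G) u ≡ 0)
    colored (i , x) nx = proj₂ (proj₂ (K-isUpKernel i ev)) x (N⇒K i x ev nx)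
      where ev = N-supported i x nx

mainTheorem13 : (n : ℕ) (G : Fin n → FinColDigraph) →
    (∀ i → 0 < FinColDigraph.size (G i)) →
    (HasUpKernel (ZykovPath n G) → ∀ k (h : 2 * k < n) → PairCondition n G k h)
    × ((∀ k (h : 2 * k < n) → PairCondition n G k h) → HasUpKernel (ZykovPath n G))
mainTheorem13 n G nonempty =
    (λ (N , isKernel) k h → absorbingKernelAt⇒pairCondition n G k h
       (evenLayer-absorbingKernel n G nonempty isKernel (fromℕ< h) (k , toℕ-fromℕ< h)))
  , λ pairs → absorbingKernels⇒hasUpKernel n G (pairConditions⇒absorbingKernels n G pairs)
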